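{- Let $G$ be a signed eulerian graph that can be decomposed into three edge-disjoint eulerian subgraphs $G_1,G_2,G_3$, each with an odd number of negative edges, having a vertex in common. Then $\Phi(G)=3$.
   Context: Graphs are finite and may have loops and multiple edges. A graph is eulerian if it is connected and every vertex has even valency. A signed graph is a graph with a signature $\sigma:E\to\{+1,-1\}$. Orientation: each edge has two half-edges; positive edges have exactly one half-edge pointing toward its end, negative edges have both pointing away or both toward their ends. A $\mathbb{Z}$-flow is $\xi:E\to\mathbb{Z}$ such that at each vertex the sum of values on half-edges directed out minus the sum on half-edges directed in is $0$. A nowhere-zero $k$-flow is a $\mathbb{Z}$-flow with values in $\{\pm1,\dots,\pm(k-1)\}$, and the flow number $\Phi(G)$ is the least $k$ for which $G$ has a nowhere-zero $k$-flow. -}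

module Defs where

open import Data.Nat using (ℕ; zero; suc; _<_)
open import Data.Nat.Divisibility using (_∣_)
open import Data.Integer as ℤ using (ℤ; 0ℤ; -_; ∣_∣)
open import Data.Fin using (Fin; zero; suc; _≟_)
open import Data.Bool using (Bool; true; false; if_then_else_)
open import Data.Product using (Σ; ∃; _×_; _,_)
open import Data.Sum using (_⊎_)
open import Relation.Nullary using (¬_; does)
open import Relation.Binary.PropositionalEquality using (_≡_; _≢_)

∑ℕ : ∀ {m} → (Fin m → ℕ) → ℕ
∑ℕ {zero}  f = 0
∑ℕ {suc m} f = f zero Data.Nat.+ ∑ℕ (λ i → f (suc i))

∑ℤ : ∀ {m} → (Fin m → ℤ) → ℤ
∑ℤ {zero}  f = 0ℤ
∑ℤ {suc m} f = f zero ℤ.+ ∑ℤ (λ i → f (suc i))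

-- A signed graph with vertices Fin n and edges Fin m (loops and multiple
-- edges allowed).  Each edge e has two half-edges (e , false) and (e , true);
-- 'end e b' is the vertex the half-edge (e , b) is attached to.
-- 'positive e ≡ true' means σ(e) = +1, otherwise σ(e) = -1.
record SignedGraph (n m : ℕ) : Set where
  field
    end      : Fin m → Bool → Fin n
    positive : Fin m → Bool
open SignedGraph public

EdgeSet : ℕ → Set
EdgeSet m = Fin m → Bool

allEdges : ∀ {m} → EdgeSet m
allEdges _ = true

module _ {n m : ℕ} (G : SignedGraph n m) where

  -- number of half-edges of edges in S attached at v (a loop counts twice)
  valency : EdgeSet m → Fin n → ℕ
  valency S v = ∑ℕ λ e → if S e
    then ((if does (end G e false ≟ v) then 1 else 0)
          Data.Nat.+ (if does (end G e true ≟ v) then 1 else 0))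
    else 0

  Incident : EdgeSet m → Fin n → Set
  Incident S v = ∃ λ e → S e ≡ true × (end G e false ≡ v ⊎ end G e true ≡ v)

  data Reach (S : EdgeSet m) : Fin n → Fin n → Set where
    here : ∀ {u} → Reach S u u
    step : ∀ {v} (e : Fin m) (b : Bool) → S e ≡ true →
           Reach S (end G e (Data.Bool.not b)) v → Reach S (end G e b) v

  Eulerian : Set
  Eulerian = (∀ u v → Reach allEdges u v) × (∀ v → 2 ∣ valency allEdges v)

  -- the subgraph with edge set S (and vertex set the ends of its edges)
  -- is eulerian
  EulerianSub : EdgeSet m → Set
  EulerianSub S = (∀ u v → Incident S u → Incident S v → Reach S u v)
                × (∀ v → 2 ∣ valency S v)

  negCount : EdgeSet m → ℕ
  negCount S = ∑ℕ λ e → if S e then (if positive G e then 0 else 1) else 0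

  OddNegative : EdgeSet m → Set
  OddNegative S = ¬ (2 ∣ negCount S)

  -- an orientation: 'out e b ≡ true' iff half-edge (e , b) is directed
  -- away from its end
  Orientation : Set
  Orientation = Fin m → Bool → Bool

  ValidOrientation : Orientation → Set
  ValidOrientation ω = ∀ e →
    (positive G e ≡ true → ω e false ≢ ω e true) ×
    (positive G e ≡ false → ω e false ≡ ω e true)

  -- outflow minus inflow at v
  netFlow : Orientation → (Fin m → ℤ) → Fin n → ℤ
  netFlow ω ξ v = ∑ℤ λ e →
    (if does (end G e false ≟ v) then (if ω e false then ξ e else - ξ e) else 0ℤ)
    ℤ.+ (if does (end G e true ≟ v) then (if ω e true then ξ e else - ξ e) else 0ℤ)

  IsFlow : Orientation → (Fin m → ℤ) → Set
  IsFlow ω ξ = ∀ v → netFlow ω ξ v ≡ 0ℤ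

  HasNZFlow : ℕ → Set
  HasNZFlow k = Σ Orientation λ ω → ValidOrientation ω × Σ (Fin m → ℤ) λ ξ →
    IsFlow ω ξ × (∀ e → ξ e ≢ 0ℤ × ∣ ξ e ∣ < k)

  FlowNumberIs : ℕ → Set
  FlowNumberIs k = HasNZFlow k × (∀ j → j < k → ¬ HasNZFlow j)

-- Summed over all vertices, the outflow of ξ under a valid orientation is the sum over the
-- edges of ξ(e)·(σ + σ') for the two half-edges of e; this is 0 on positive edges and ±2ξ(e)
-- on negative ones.  Hence any flow-like function with values ±1 on an edge set with an odd
-- number of negative edges has total outflow ≡ 2 (mod 4), in particular nonzero.
-- Lower bound: a nowhere-zero 2-flow on G would be such a function with total outflow 0.
-- Upper bound: walking once around an Euler circuit of Gᵢ from the common vertex v and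
-- orienting each half-edge along the walk gives a ±1-valued function fᵢ on Gᵢ that is balanced
-- at every vertex except v, where its outflow is ±1 ± 1; by the above it is 2.  Then
-- 2f₁ − f₂ − f₃ is a nowhere-zero 3-flow on G.
module Submission where

open import Defs
open import Data.Nat using (ℕ)
open import Data.Fin using (Fin)
open import Data.Bool using (true; false)
open import Data.Product using (_×_)
import Data.Sum
open import Relation.Binary.PropositionalEquality using (_≡_)

open import Algebra.Bundles using (Semiring)
import Algebra.Properties.Semiring.Sum as SemiringSum
open import Data.Bool using (Bool; not; if_then_else_)
import Data.Bool as Bool
import Data.Bool.Properties as Bool
open import Data.Empty using (⊥-elim)
open import Data.Fin using (zero; suc; _≟_)
open import Data.Fin.Properties using (any?; punchInᵢ≢i)
open import Data.Integer using (ℤ; +_; -[1+_]; 0ℤ; 1ℤ; -1ℤ; _+_; _-_; _*_; -_; ∣_∣)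
import Data.Integer.Properties as ℤ
open import Data.Integer.Divisibility.Signed
  using (_∣_; divides; ∣-refl; ∣m∣n⇒∣m+n; ∣m⇒∣-m; ∣m+n∣n⇒∣m; ∣n⇒∣m*n; *-monoʳ-∣; ∣⇒∣ᵤ; ∣ᵤ⇒∣)
open import Data.Integer.Tactic.RingSolver using (solve-∀)
open import Data.List using (List; []; _∷_; _++_; _∷ʳ_; [_]; length)
import Data.List.Properties as List
open import Data.List.Relation.Binary.Permutation.Propositional as ↭
  using (_↭_; module PermutationReasoning)
open import Data.List.Relation.Binary.Permutation.Propositional.Properties using (++-comm)
import Data.Nat as ℕ
import Data.Nat.Properties as ℕ
import Data.Nat.Divisibility as ℕ
open import Algebra.Properties.CommutativeSemigroup ℕ.+-commutativeSemigroup using (x∙yz≈y∙xz)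
open import Data.Product using (Σ; ∃; ∃₂; _,_; proj₁; proj₂)
open import Data.Sum using (_⊎_; inj₁; inj₂)
open import Function using (_∘_)
open import Relation.Nullary using (¬_; Dec; does; yes; no)
open import Relation.Nullary.Decidable using (dec-true; dec-false; _×-dec_; _⊎-dec_)
open import Relation.Binary.PropositionalEquality
  using (refl; sym; trans; cong; cong₂; subst; subst₂; _≢_; ≢-sym; module ≡-Reasoning)

module SumProperties {c ℓ} (R : Semiring c ℓ) where
  open Semiring R using (Carrier; _≈_; 0#; setoid; +-congˡ; +-identityʳ) renaming (_+_ to _⊕_)
  open SemiringSum R public
  open import Relation.Binary.Reasoning.Setoid setoid

  sum-point : ∀ {k} (f : Fin k → Carrier) j → (∀ i → i ≢ j → f i ≈ 0#) → sum f ≈ f j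
  sum-point {ℕ.suc k} f j f≈0 = begin
    sum f                    ≈⟨ sum-remove {i = j} f ⟩
    f j ⊕ sum (f ∘ punchIn)  ≈⟨ +-congˡ (sum-cong-≋ {k} (λ i → f≈0 _ (punchInᵢ≢i j i))) ⟩
    f j ⊕ sum {k} (λ _ → 0#) ≈⟨ +-congˡ (sum-replicate-zero k) ⟩
    f j ⊕ 0#                 ≈⟨ +-identityʳ (f j) ⟩
    f j                      ∎
    where punchIn = Data.Fin.punchIn j

module ℤΣ = SumProperties ℤ.+-*-semiring
module ℕΣ = SumProperties ℕ.+-*-semiring

∑ℤ≡sum : ∀ {k} (f : Fin k → ℤ) → ∑ℤ f ≡ ℤΣ.sum f
∑ℤ≡sum {ℕ.zero}  f = refl
∑ℤ≡sum {ℕ.suc k} f = cong (λ s → f zero + s) (∑ℤ≡sum (f ∘ suc))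

∑ℕ≡sum : ∀ {k} (f : Fin k → ℕ) → ∑ℕ f ≡ ℕΣ.sum f
∑ℕ≡sum {ℕ.zero}  f = refl
∑ℕ≡sum {ℕ.suc k} f = cong (f zero ℕ.+_) (∑ℕ≡sum (f ∘ suc))

sum-pos : ∀ {k} (f : Fin k → ℕ) → ℤΣ.sum (λ i → + f i) ≡ + ℕΣ.sum f
sum-pos {ℕ.zero}  f = refl
sum-pos {ℕ.suc k} f =
  trans (cong (λ s → + f zero + s) (sum-pos (f ∘ suc))) (sym (ℤ.pos-+ (f zero) _))

sum-mono-≤ : ∀ {k} {f g : Fin k → ℕ} → (∀ i → f i ℕ.≤ g i) → ℕΣ.sum f ℕ.≤ ℕΣ.sum g
sum-mono-≤ {ℕ.zero}  f≤g = ℕ.z≤n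
sum-mono-≤ {ℕ.suc k} f≤g = ℕ.+-mono-≤ (f≤g zero) (sum-mono-≤ (f≤g ∘ suc))

sum-mono-< : ∀ {k} {f g : Fin k → ℕ} → (∀ i → f i ℕ.≤ g i) → ∀ j → f j ℕ.< g j →
             ℕΣ.sum f ℕ.< ℕΣ.sum g
sum-mono-< f≤g zero    lt = ℕ.+-mono-<-≤ lt (sum-mono-≤ (f≤g ∘ suc))
sum-mono-< f≤g (suc j) lt = ℕ.+-mono-≤-< (f≤g zero) (sum-mono-< (f≤g ∘ suc) j lt)

sum-congruent : ∀ {k} {d : ℤ} (f g : Fin k → ℤ) → (∀ i → d ∣ f i - g i) →
                d ∣ ℤΣ.sum f - ℤΣ.sum g
sum-congruent {ℕ.zero}  f g f≡g = divides 0ℤ refl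
sum-congruent {ℕ.suc k} f g f≡g =
  subst (_ ∣_) (shuffle (f zero) (g zero) (ℤΣ.sum (f ∘ suc)) (ℤΣ.sum (g ∘ suc)))
        (∣m∣n⇒∣m+n (f≡g zero) (sum-congruent (f ∘ suc) (g ∘ suc) (f≡g ∘ suc)))
  where
  shuffle : ∀ a b c d → (a - b) + (c - d) ≡ (a + c) - (b + d)
  shuffle = solve-∀

∣-diff-trans : ∀ {d x y z} → d ∣ x - y → d ∣ y - z → d ∣ x - z
∣-diff-trans {x = x} {y} {z} p q = subst (_ ∣_) (telescope x y z) (∣m∣n⇒∣m+n p q)
  where
  telescope : ∀ x y z → (x - y) + (y - z) ≡ x - z
  telescope = solve-∀

∣-diff⇒∣ : ∀ {d x y} → d ∣ x - y → d ∣ y → d ∣ x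
∣-diff⇒∣ p q = ∣m+n∣n⇒∣m p (∣m⇒∣-m q)

odd⇒∣pred : ∀ {k} → ¬ 2 ℕ.∣ k → + 2 ∣ + k - 1ℤ
odd⇒∣pred {ℕ.zero}            odd = ⊥-elim (odd (ℕ.divides 0 refl))
odd⇒∣pred {ℕ.suc ℕ.zero}      odd = divides 0ℤ refl
odd⇒∣pred {ℕ.suc (ℕ.suc k)}   odd =
  subst (+ 2 ∣_) (add-two (+ k)) (∣m∣n⇒∣m+n (odd⇒∣pred (odd ∘ ℕ.∣m∣n⇒∣m+n ℕ.∣-refl)) ∣-refl)
  where
  add-two : ∀ x → (x - 1ℤ) + + 2 ≡ (+ 2 + x) - 1ℤ
  add-two = solve-∀

∣-odd-sum₃ : ∀ {a b c} → + 2 ∣ a - 1ℤ → + 2 ∣ b - 1ℤ → + 2 ∣ c - 1ℤ → + 2 ∣ (a + (b + c)) - 1ℤ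
∣-odd-sum₃ {a} {b} {c} p q r =
  subst (+ 2 ∣_) (regroup a b c) (∣m∣n⇒∣m+n p (∣m∣n⇒∣m+n q (∣m∣n⇒∣m+n r ∣-refl)))
  where
  regroup : ∀ a b c → (a - 1ℤ) + ((b - 1ℤ) + ((c - 1ℤ) + + 2)) ≡ (a + (b + c)) - 1ℤ
  regroup = solve-∀

𝟙 : Bool → ℕ
𝟙 b = if b then 1 else 0

signed : Bool → ℤ → ℤ
signed w x = if w then x else - x

σ : Bool → ℤ
σ w = signed w 1ℤ

σ-not : ∀ w → σ (not w) ≡ - σ w
σ-not true  = refl
σ-not false = refl

2∤-σ : ∀ w → ¬ (+ 2 ∣ 0ℤ - σ w)
2∤-σ true  d with ℕ.∣⇒≤ (∣⇒∣ᵤ d)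
... | ℕ.s≤s ()
2∤-σ false d with ℕ.∣⇒≤ (∣⇒∣ᵤ d)
... | ℕ.s≤s ()

4∤-2 : ¬ (+ 4 ∣ 0ℤ - + 2)
4∤-2 d with ℕ.∣⇒≤ (∣⇒∣ᵤ d)
... | ℕ.s≤s (ℕ.s≤s ())

if-signed : ∀ d w x → (if d then signed w x else 0ℤ) ≡ x * (if d then σ w else 0ℤ)
if-signed false w     x = sym (ℤ.*-zeroʳ x)
if-signed true  true  x = sym (ℤ.*-identityʳ x)
if-signed true  false x = neg-as-product x
  where
  neg-as-product : ∀ x → - x ≡ x * -1ℤ
  neg-as-product = solve-∀

if-neg : ∀ d x → (if d then - x else 0ℤ) ≡ - (if d then x else 0ℤ)
if-neg true  x = refl
if-neg false x = refl

if-σ-parity : ∀ d w → + 2 ∣ (if d then σ w else 0ℤ) - + 𝟙 d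
if-σ-parity false w     = divides 0ℤ refl
if-σ-parity true  true  = divides 0ℤ refl
if-σ-parity true  false = divides -1ℤ refl

charge-valid : ∀ p w₀ w₁ → (p ≡ true → w₀ ≢ w₁) → (p ≡ false → w₀ ≡ w₁) →
               σ w₀ + σ w₁ ≡ (if p then 0ℤ else + 2 * σ w₀)
charge-valid true  true  true  opp _ = ⊥-elim (opp refl refl)
charge-valid true  true  false _   _ = refl
charge-valid true  false true  _   _ = refl
charge-valid true  false false opp _ = ⊥-elim (opp refl refl)
charge-valid false true  true  _   _ = refl
charge-valid false true  false _ same with same refl
... | ()
charge-valid false false true  _ same with same refl
... | ()
charge-valid false false false _   _ = refl

UnitIf : Bool → ℤ → Set
UnitIf true  x = x ≡ 1ℤ ⊎ x ≡ -1ℤ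
UnitIf false x = x ≡ 0ℤ

charge-mod4 : ∀ p s w x → UnitIf s x →
  + 4 ∣ x * (if p then 0ℤ else + 2 * σ w) - + 2 * + (if s then (if p then 0 else 1) else 0)
charge-mod4 p     false w     _ refl        = divides 0ℤ refl
charge-mod4 true  true  w     _ (inj₁ refl) = divides 0ℤ refl
charge-mod4 true  true  w     _ (inj₂ refl) = divides 0ℤ refl
charge-mod4 false true  true  _ (inj₁ refl) = divides 0ℤ refl
charge-mod4 false true  false _ (inj₁ refl) = divides -1ℤ refl
charge-mod4 false true  true  _ (inj₂ refl) = divides -1ℤ refl
charge-mod4 false true  false _ (inj₂ refl) = divides 0ℤ refl

unit-if-small : ∀ x → x ≢ 0ℤ → ∣ x ∣ ℕ.< 2 → UnitIf true x
unit-if-small (+ 0)              x≢0 _ = ⊥-elim (x≢0 refl)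
unit-if-small (+ 1)              _   _ = inj₁ refl
unit-if-small (+ ℕ.suc (ℕ.suc _)) _  (ℕ.s≤s (ℕ.s≤s ()))
unit-if-small (-[1+ 0 ])       _   _ = inj₂ refl
unit-if-small (-[1+ ℕ.suc _ ]) _   (ℕ.s≤s (ℕ.s≤s ()))

ExactlyOne : Bool → Bool → Bool → Set
ExactlyOne a b c = (a ≡ true × b ≡ false × c ≡ false)
                 ⊎ ((a ≡ false × b ≡ true × c ≡ false) ⊎ (a ≡ false × b ≡ false × c ≡ true))

exactlyOne-split : ∀ {a b c} (x : ℕ) → ExactlyOne a b c →
  x ≡ (if a then x else 0) ℕ.+ ((if b then x else 0) ℕ.+ (if c then x else 0))
exactlyOne-split x (inj₁ (refl , refl , refl))        = sym (ℕ.+-identityʳ x)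
exactlyOne-split x (inj₂ (inj₁ (refl , refl , refl))) = sym (ℕ.+-identityʳ x)
exactlyOne-split x (inj₂ (inj₂ (refl , refl , refl))) = refl

exactlyOne-value : ∀ {a b c} → ExactlyOne a b c →
  let x = + 2 * + 𝟙 a + (-1ℤ * + 𝟙 b + -1ℤ * + 𝟙 c) in x ≢ 0ℤ × ∣ x ∣ ℕ.< 3
exactlyOne-value (inj₁ (refl , refl , refl))        = (λ ()) , ℕ.s≤s (ℕ.s≤s (ℕ.s≤s ℕ.z≤n))
exactlyOne-value (inj₂ (inj₁ (refl , refl , refl))) = (λ ()) , ℕ.s≤s (ℕ.s≤s ℕ.z≤n)
exactlyOne-value (inj₂ (inj₂ (refl , refl , refl))) = (λ ()) , ℕ.s≤s (ℕ.s≤s ℕ.z≤n)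

exactlyOne-agree : ∀ {a b c} {A : Set} (o₁ o₂ o₃ : A) → ExactlyOne a b c →
  let o = if a then o₁ else (if b then o₂ else o₃) in
  (+ 𝟙 a ≡ 0ℤ ⊎ o ≡ o₁) × (+ 𝟙 b ≡ 0ℤ ⊎ o ≡ o₂) × (+ 𝟙 c ≡ 0ℤ ⊎ o ≡ o₃)
exactlyOne-agree o₁ o₂ o₃ (inj₁ (refl , refl , refl))        = inj₂ refl , inj₁ refl , inj₁ refl
exactlyOne-agree o₁ o₂ o₃ (inj₂ (inj₁ (refl , refl , refl))) = inj₁ refl , inj₂ refl , inj₁ refl
exactlyOne-agree o₁ o₂ o₃ (inj₂ (inj₂ (refl , refl , refl))) = inj₁ refl , inj₁ refl , inj₂ refl

arrival-valid : ∀ p s → (p ≡ true → s ≢ (if p then not s else s))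
                      × (p ≡ false → s ≡ (if p then not s else s))
arrival-valid true  s = (λ _ → Bool.not-¬ refl) , (λ ())
arrival-valid false s = (λ ()) , (λ _ → refl)

𝟙≤1 : ∀ s → 𝟙 s ℕ.≤ 1
𝟙≤1 true  = ℕ.≤-refl
𝟙≤1 false = ℕ.z≤n

≤𝟙-* : ∀ s k c → k ℕ.≤ 𝟙 s → (s ≡ true → k ≡ 0 → c ≡ 0) → k ℕ.* c ≡ (if s then c else 0)
≤𝟙-* false _               c ℕ.z≤n           _ = refl
≤𝟙-* true  0               c _               c≡0 = sym (c≡0 refl refl)
≤𝟙-* true  1               c _               _ = ℕ.+-identityʳ c
≤𝟙-* true  (ℕ.suc (ℕ.suc _)) c (ℕ.s≤s ())    _

≤𝟙-exact : ∀ {s k} → k ℕ.≤ 𝟙 s → ¬ (s ≡ true × k ≡ 0) → k ≡ 𝟙 s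
≤𝟙-exact {false} ℕ.z≤n _ = refl
≤𝟙-exact {true} {0} _ k≢0 = ⊥-elim (k≢0 (refl , refl))
≤𝟙-exact {true} {1} _ _   = refl
≤𝟙-exact {true} {ℕ.suc (ℕ.suc _)} (ℕ.s≤s ()) _

refuel : ∀ {a b c k} → a ℕ.≤ b ℕ.+ ℕ.suc k → b ℕ.< c → a ℕ.≤ c ℕ.+ k
refuel {b = b} {k = k} fuel b<c =
  ℕ.≤-trans fuel (ℕ.≤-trans (ℕ.≤-reflexive (ℕ.+-suc b k)) (ℕ.+-monoˡ-≤ k b<c))

1-σ≢0 : ∀ f → 1ℤ - σ f ≢ 0ℤ → f ≡ false
1-σ≢0 true  nonzero = ⊥-elim (nonzero refl)
1-σ≢0 false _       = refl

if-1-σfalse : ∀ d → (if d then 1ℤ else 0ℤ) - (if d then σ false else 0ℤ) ≡ (if d then + 2 else 0ℤ)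
if-1-σfalse true  = refl
if-1-σfalse false = refl

Step : ℕ → Set
Step m = Fin m × Bool

point : ∀ {n} → Fin n → ℤ → Fin n → ℤ
point x c u = if does (x ≟ u) then c else 0ℤ

point-≡ : ∀ {n} (x : Fin n) c → point x c x ≡ c
point-≡ x c = cong (λ d → if d then c else 0ℤ) (dec-true (x ≟ x) refl)

point-≢ : ∀ {n} {x u : Fin n} c → x ≢ u → point x c u ≡ 0ℤ
point-≢ {x = x} {u} c x≢u = cong (λ d → if d then c else 0ℤ) (dec-false (x ≟ u) x≢u)

sum-point-mass : ∀ {n} (x : Fin n) c → ℤΣ.sum (point x c) ≡ c
sum-point-mass x c =
  trans (ℤΣ.sum-point (point x c) x (λ u u≢x → point-≢ c (≢-sym u≢x))) (point-≡ x c)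

-- Net flow as a linear function of ξ

module _ {n m : ℕ} (G : SignedGraph n m) where

  incidenceAt : Fin m → (Bool → Bool) → Fin n → ℤ
  incidenceAt e o u = point (end G e false) (σ (o false)) u + point (end G e true) (σ (o true)) u

  incidence : Orientation G → Fin n → Fin m → ℤ
  incidence ω u e = incidenceAt e (ω e) u

  netFlow≡sum-incidence : ∀ ω ξ u → netFlow G ω ξ u ≡ ℤΣ.sum (λ e → ξ e * incidence ω u e)
  netFlow≡sum-incidence ω ξ u = trans (∑ℤ≡sum (λ e → edgeFlow e)) (ℤΣ.sum-cong-≗ λ e →
    trans (cong₂ _+_ (if-signed (does (end G e false ≟ u)) (ω e false) (ξ e))
                     (if-signed (does (end G e true ≟ u)) (ω e true) (ξ e)))
          (sym (ℤ.*-distribˡ-+ (ξ e) _ _)))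
    where
    edgeFlow : Fin m → ℤ
    edgeFlow e = point (end G e false) (signed (ω e false) (ξ e)) u
               + point (end G e true) (signed (ω e true) (ξ e)) u

  netFlow-cong : ∀ {ω ω' ξ ξ'} u → (∀ e → ξ e * incidence ω u e ≡ ξ' e * incidence ω' u e) →
                 netFlow G ω ξ u ≡ netFlow G ω' ξ' u
  netFlow-cong {ω} {ω'} {ξ} {ξ'} u same = begin
    netFlow G ω ξ u                             ≡⟨ netFlow≡sum-incidence ω ξ u ⟩
    ℤΣ.sum (λ e → ξ e * incidence ω u e)        ≡⟨ ℤΣ.sum-cong-≗ same ⟩
    ℤΣ.sum (λ e → ξ' e * incidence ω' u e)      ≡⟨ netFlow≡sum-incidence ω' ξ' u ⟨
    netFlow G ω' ξ' u                           ∎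
    where open ≡-Reasoning

  netFlow-congˡ : ∀ ω {ξ ξ'} → (∀ e → ξ e ≡ ξ' e) → ∀ u → netFlow G ω ξ u ≡ netFlow G ω ξ' u
  netFlow-congˡ ω {ξ} {ξ'} ξ≗ξ' u =
    netFlow-cong {ω} {ω} {ξ} {ξ'} u (λ e → cong (_* incidence ω u e) (ξ≗ξ' e))

  netFlow-local : ∀ {ω ω'} ξ → (∀ e → ξ e ≡ 0ℤ ⊎ ω e ≡ ω' e) → ∀ u →
                  netFlow G ω ξ u ≡ netFlow G ω' ξ u
  netFlow-local {ω} {ω'} ξ agree u = netFlow-cong {ω} {ω'} {ξ} {ξ} u λ e → case e (agree e)
    where
    case : ∀ e → ξ e ≡ 0ℤ ⊎ _ → _
    case e (inj₁ ξ≡0) = trans (cong (_* _) ξ≡0) (sym (cong (_* _) ξ≡0))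
    case e (inj₂ ω≡ω') = cong (λ o → ξ e * incidenceAt e o u) ω≡ω'

  netFlow-zero : ∀ ω u → netFlow G ω (λ _ → 0ℤ) u ≡ 0ℤ
  netFlow-zero ω u = trans (netFlow≡sum-incidence ω _ u) (ℤΣ.sum-replicate-zero m)

  netFlow-+ : ∀ ω ξ ξ' u → netFlow G ω (λ e → ξ e + ξ' e) u ≡ netFlow G ω ξ u + netFlow G ω ξ' u
  netFlow-+ ω ξ ξ' u = begin
    netFlow G ω (λ e → ξ e + ξ' e) u                   ≡⟨ netFlow≡sum-incidence ω _ u ⟩
    ℤΣ.sum (λ e → (ξ e + ξ' e) * incidence ω u e)
      ≡⟨ ℤΣ.sum-cong-≗ (λ e → ℤ.*-distribʳ-+ (incidence ω u e) (ξ e) (ξ' e)) ⟩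
    ℤΣ.sum (λ e → ξ e * incidence ω u e + ξ' e * incidence ω u e)
      ≡⟨ ℤΣ.∑-distrib-+ (λ e → ξ e * incidence ω u e) (λ e → ξ' e * incidence ω u e) ⟩
    ℤΣ.sum (λ e → ξ e * incidence ω u e) + ℤΣ.sum (λ e → ξ' e * incidence ω u e)
      ≡⟨ cong₂ _+_ (netFlow≡sum-incidence ω ξ u) (netFlow≡sum-incidence ω ξ' u) ⟨
    netFlow G ω ξ u + netFlow G ω ξ' u                 ∎
    where open ≡-Reasoning

  netFlow-* : ∀ ω k ξ u → netFlow G ω (λ e → k * ξ e) u ≡ k * netFlow G ω ξ u
  netFlow-* ω k ξ u = begin
    netFlow G ω (λ e → k * ξ e) u                       ≡⟨ netFlow≡sum-incidence ω _ u ⟩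
    ℤΣ.sum (λ e → k * ξ e * incidence ω u e)
      ≡⟨ ℤΣ.sum-cong-≗ (λ e → ℤ.*-assoc k (ξ e) (incidence ω u e)) ⟩
    ℤΣ.sum (λ e → k * (ξ e * incidence ω u e))
      ≡⟨ ℤΣ.*-distribˡ-sum k (λ e → ξ e * incidence ω u e) ⟨
    k * ℤΣ.sum (λ e → ξ e * incidence ω u e)
      ≡⟨ cong (k *_) (netFlow≡sum-incidence ω ξ u) ⟨
    k * netFlow G ω ξ u                                 ∎
    where open ≡-Reasoning

  netFlow-indicator : ∀ ω e u → netFlow G ω (λ e' → + 𝟙 (does (e ≟ e'))) u ≡ incidence ω u e
  netFlow-indicator ω e u =
    trans (netFlow≡sum-incidence ω _ u)
    (trans (ℤΣ.sum-point _ e (λ e' e'≢e →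
             cong (λ d → + 𝟙 d * incidence ω u e') (dec-false (e ≟ e') (≢-sym e'≢e))))
    (trans (cong (λ d → + 𝟙 d * incidence ω u e) (dec-true (e ≟ e) refl)) (ℤ.*-identityˡ _)))

  charge : Orientation G → Fin m → ℤ
  charge ω e = σ (ω e false) + σ (ω e true)

  sum-netFlow : ∀ ω ξ → ℤΣ.sum (netFlow G ω ξ) ≡ ℤΣ.sum (λ e → ξ e * charge ω e)
  sum-netFlow ω ξ = begin
    ℤΣ.sum (netFlow G ω ξ)
      ≡⟨ ℤΣ.sum-cong-≗ (netFlow≡sum-incidence ω ξ) ⟩
    ℤΣ.sum (λ u → ℤΣ.sum (λ e → ξ e * incidence ω u e))
      ≡⟨ ℤΣ.∑-comm (λ u e → ξ e * incidence ω u e) ⟩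
    ℤΣ.sum (λ e → ℤΣ.sum (λ u → ξ e * incidence ω u e))
      ≡⟨ ℤΣ.sum-cong-≗ (λ e → ℤΣ.*-distribˡ-sum (ξ e) (λ u → incidence ω u e)) ⟨
    ℤΣ.sum (λ e → ξ e * ℤΣ.sum (λ u → incidence ω u e))
      ≡⟨ ℤΣ.sum-cong-≗ (λ e → cong (ξ e *_) (sum-incidence e)) ⟩
    ℤΣ.sum (λ e → ξ e * charge ω e)                           ∎
    where
    open ≡-Reasoning
    sum-incidence : ∀ e → ℤΣ.sum (λ u → incidence ω u e) ≡ charge ω e
    sum-incidence e =
      trans (ℤΣ.∑-distrib-+ (point (end G e false) (σ (ω e false)))
                            (point (end G e true) (σ (ω e true))))
      (cong₂ _+_ (sum-point-mass (end G e false) _) (sum-point-mass (end G e true) _))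

  ends : Fin m → Fin n → ℕ
  ends e u = 𝟙 (does (end G e false ≟ u)) ℕ.+ 𝟙 (does (end G e true ≟ u))

  netFlow-parity : ∀ ω ξ u → + 2 ∣ netFlow G ω ξ u - ℤΣ.sum (λ e → ξ e * + ends e u)
  netFlow-parity ω ξ u =
    subst (λ t → + 2 ∣ t - _) (sym (netFlow≡sum-incidence ω ξ u))
      (sum-congruent (λ e → ξ e * incidence ω u e) (λ e → ξ e * + ends e u) λ e →
        subst (+ 2 ∣_) (factor (ξ e) _ _) (∣n⇒∣m*n (ξ e) (incidence-parity e)))
    where
    factor : ∀ a x y → a * (x - y) ≡ a * x - a * y
    factor = solve-∀
    regroup : ∀ a b c d → (a - c) + (b - d) ≡ (a + b) - (c + d)
    regroup = solve-∀
    incidence-parity : ∀ e → + 2 ∣ incidence ω u e - + ends e u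
    incidence-parity e =
      subst (+ 2 ∣_) (trans (regroup h₀ h₁ (+ 𝟙 d₀) (+ 𝟙 d₁))
                            (cong (λ t → incidence ω u e - t) (sym (ℤ.pos-+ (𝟙 d₀) (𝟙 d₁)))))
        (∣m∣n⇒∣m+n (if-σ-parity d₀ (ω e false)) (if-σ-parity d₁ (ω e true)))
      where
      d₀ = does (end G e false ≟ u)
      d₁ = does (end G e true ≟ u)
      h₀ = point (end G e false) (σ (ω e false)) u
      h₁ = point (end G e true) (σ (ω e true)) u

  negative-in : EdgeSet m → Fin m → ℕ
  negative-in S e = if S e then (if positive G e then 0 else 1) else 0

  UnitOn : EdgeSet m → (Fin m → ℤ) → Set
  UnitOn S ξ = ∀ e → UnitIf (S e) (ξ e)

  sum-netFlow-mod4 : ∀ {ω ξ} S → ValidOrientation G ω → UnitOn S ξ →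
    + 2 ∣ + negCount G S - 1ℤ → + 4 ∣ ℤΣ.sum (netFlow G ω ξ) - + 2
  sum-netFlow-mod4 {ω} {ξ} S valid unit odd =
    ∣-diff-trans {x = ℤΣ.sum (netFlow G ω ξ)} {y = + 2 * + negCount G S} {z = + 2}
      (subst₂ (λ t t' → + 4 ∣ t - t') (sym (sum-netFlow ω ξ)) twice-negatives
        (sum-congruent (λ e → ξ e * charge ω e) (λ e → + 2 * + negative-in S e) per-edge))
      (subst (+ 4 ∣_) (double (+ negCount G S)) (*-monoʳ-∣ (+ 2) odd))
    where
    per-edge : ∀ e → + 4 ∣ ξ e * charge ω e - + 2 * + negative-in S e
    per-edge e = subst (λ c → + 4 ∣ ξ e * c - _)
      (sym (charge-valid (positive G e) (ω e false) (ω e true) (proj₁ (valid e)) (proj₂ (valid e))))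
      (charge-mod4 (positive G e) (S e) (ω e false) (ξ e) (unit e))
    twice-negatives : ℤΣ.sum (λ e → + 2 * + negative-in S e) ≡ + 2 * + negCount G S
    twice-negatives = trans (sym (ℤΣ.*-distribˡ-sum (+ 2) (λ e → + negative-in S e)))
      (cong (+ 2 *_) (trans (sum-pos (negative-in S)) (cong +_ (sym (∑ℕ≡sum (negative-in S))))))
    double : ∀ x → + 2 * (x - 1ℤ) ≡ + 2 * x - + 2
    double = solve-∀

  sum-netFlow≢0 : ∀ {ω ξ} S → ValidOrientation G ω → UnitOn S ξ →
    + 2 ∣ + negCount G S - 1ℤ → ℤΣ.sum (netFlow G ω ξ) ≢ 0ℤ
  sum-netFlow≢0 {ω} {ξ} S valid unit odd total≡0 =
    4∤-2 (subst (λ t → + 4 ∣ t - + 2) total≡0 (sum-netFlow-mod4 {ω} {ξ} S valid unit odd))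

  -- Orientations induced by walks

  ValidAt : Fin m → (Bool → Bool) → Set
  ValidAt e o = (positive G e ≡ true → o false ≢ o true) × (positive G e ≡ false → o false ≡ o true)

  patch : EdgeSet m → Orientation G → Orientation G → Orientation G
  patch S ω ω' e = if S e then ω e else ω' e

  patch-valid : ∀ S {ω ω'} → ValidOrientation G ω → ValidOrientation G ω' →
                ValidOrientation G (patch S ω ω')
  patch-valid S valid valid' e with S e
  ... | true  = valid e
  ... | false = valid' e

  -- A walker leaves a vertex by a half-edge directed away from it (s = true) or towards it;
  -- the sign of the edge fixes the direction of the half-edge it arrives by, and it leaves the
  -- next vertex in the opposite direction, so that vertex stays balanced.
  arrival : Bool → Fin m → Bool
  arrival s e = if positive G e then not s else s

  next : Bool → Fin m → Bool
  next s e = not (arrival s e)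

  traverse : Bool → Fin m → Bool → Bool → Bool
  traverse s e b b' = if does (b' Bool.≟ b) then s else arrival s e

  traverse-valid : ∀ s e b → ValidAt e (traverse s e b)
  traverse-valid s e false = arrival-valid (positive G e) s
  traverse-valid s e true  with arrival-valid (positive G e) s
  ... | opposite , same = (λ p → ≢-sym (opposite p)) , (λ p → sym (same p))

  incidence-traverse : ∀ s e b u → incidenceAt e (traverse s e b) u
                     ≡ point (end G e b) (σ s) u + point (end G e (not b)) (σ (arrival s e)) u
  incidence-traverse s e false u = refl
  incidence-traverse s e true  u =
    ℤ.+-comm (point (end G e false) (σ (arrival s e)) u) (point (end G e true) (σ s) u)

  -- edges off the walk get an arbitrary valid orientation
  orient : Bool → List (Step m) → Orientation G
  orient s []            e' = traverse true e' false
  orient s ((e , b) ∷ T) e' = if does (e ≟ e') then traverse s e b else orient (next s e) T e'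

  exit : Bool → List (Step m) → Bool
  exit s []            = s
  exit s ((e , _) ∷ T) = exit (next s e) T

  orient-valid : ∀ s T → ValidOrientation G (orient s T)
  orient-valid s []            e' = traverse-valid true e' false
  orient-valid s ((e , b) ∷ T) e' with e ≟ e'
  ... | yes refl = traverse-valid s e b
  ... | no  _    = orient-valid (next s e) T e'

  orient-head : ∀ s e b T → orient s ((e , b) ∷ T) e ≡ traverse s e b
  orient-head s e b T =
    cong (λ d → if d then traverse s e b else orient (next s e) T e) (dec-true (e ≟ e) refl)

  data Walk : Fin n → List (Step m) → Fin n → Set where
    []  : ∀ {x} → Walk x [] x
    _∷_ : ∀ {x e b T y} → end G e b ≡ x → Walk (end G e (not b)) T y → Walk x ((e , b) ∷ T) y

  _++ʷ_ : ∀ {x y z A B} → Walk x A y → Walk y B z → Walk x (A ++ B) z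
  []      ++ʷ w' = w'
  (p ∷ w) ++ʷ w' = p ∷ (w ++ʷ w')

  uses : List (Step m) → Fin m → ℕ
  uses []            _  = 0
  uses ((e , _) ∷ T) e' = 𝟙 (does (e ≟ e')) ℕ.+ uses T e'

  uses-head : ∀ e b T → uses ((e , b) ∷ T) e ≡ ℕ.suc (uses T e)
  uses-head e b T = cong (λ d → 𝟙 d ℕ.+ uses T e) (dec-true (e ≟ e) refl)

  trail-netFlow : ∀ {x T y} → Walk x T y → (∀ e → uses T e ℕ.≤ 1) → ∀ s u →
    netFlow G (orient s T) (λ e → + uses T e) u ≡ point x (σ s) u - point y (σ (exit s T)) u
  trail-netFlow {x} [] _ s u =
    trans (netFlow-zero (orient s []) u) (sym (ℤ.+-inverseʳ (point x (σ s) u)))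
  trail-netFlow {T = (e , b) ∷ T} {y} (refl ∷ w) trail s u = begin
    netFlow G ω (λ e' → + uses ((e , b) ∷ T) e') u
      ≡⟨ netFlow-congˡ ω (λ e' → ℤ.pos-+ (𝟙 (does (e ≟ e'))) (uses T e')) u ⟩
    netFlow G ω (λ e' → + 𝟙 (does (e ≟ e')) + + uses T e') u
      ≡⟨ netFlow-+ ω (λ e' → + 𝟙 (does (e ≟ e'))) (λ e' → + uses T e') u ⟩
    netFlow G ω (λ e' → + 𝟙 (does (e ≟ e'))) u + netFlow G ω (λ e' → + uses T e') u
      ≡⟨ cong₂ _+_ first-step rest ⟩
    (point x (σ s) u + point x' (σ a) u) + (point x' (σ (not a)) u - point y (σ (exit s' T)) u)
      ≡⟨ cong (λ t → (point x (σ s) u + point x' (σ a) u) + (t - point y (σ (exit s' T)) u))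
              (trans (cong (λ c → point x' c u) (σ-not a)) (if-neg _ (σ a))) ⟩
    (point x (σ s) u + point x' (σ a) u) + (- point x' (σ a) u - point y (σ (exit s' T)) u)
      ≡⟨ cancel (point x (σ s) u) (point x' (σ a) u) (point y (σ (exit s' T)) u) ⟩
    point x (σ s) u - point y (σ (exit s' T)) u ∎
    where
    open ≡-Reasoning
    ω = orient s ((e , b) ∷ T)
    x = end G e b
    x' = end G e (not b)
    a = arrival s e
    s' = next s e
    unused : uses T e ≡ 0
    unused = ℕ.n≤0⇒n≡0 (ℕ.≤-pred (subst (ℕ._≤ 1) (uses-head e b T) (trail e)))
    agree : ∀ e' → + uses T e' ≡ 0ℤ ⊎ ω e' ≡ orient s' T e'
    agree e' with e ≟ e'
    ... | yes refl = inj₁ (cong +_ unused)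
    ... | no _     = inj₂ refl
    first-step : netFlow G ω (λ e' → + 𝟙 (does (e ≟ e'))) u ≡ point x (σ s) u + point x' (σ a) u
    first-step = trans (netFlow-indicator ω e u)
      (trans (cong (λ o → incidenceAt e o u) (orient-head s e b T)) (incidence-traverse s e b u))
    rest : netFlow G ω (λ e' → + uses T e') u ≡ point x' (σ s') u - point y (σ (exit s' T)) u
    rest = trans (netFlow-local (λ e' → + uses T e') agree u)
      (trail-netFlow w (λ e' → ℕ.≤-trans (ℕ.m≤n+m (uses T e') _) (trail e')) s' u)
    cancel : ∀ X A Y → (X + A) + (- A - Y) ≡ X - Y
    cancel = solve-∀

  -- Euler circuits

  Unused : EdgeSet m → List (Step m) → Fin m → Set
  Unused S T e = S e ≡ true × uses T e ≡ 0

  unused? : ∀ S T e → Dec (Unused S T e)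
  unused? S T e = (S e Bool.≟ true) ×-dec (uses T e ℕ.≟ 0)

  TrailIn : EdgeSet m → List (Step m) → Set
  TrailIn S T = ∀ e → uses T e ℕ.≤ 𝟙 (S e)

  trailIn⇒trail : ∀ {S T} → TrailIn S T → ∀ e → uses T e ℕ.≤ 1
  trailIn⇒trail {S} trail e = ℕ.≤-trans (trail e) (𝟙≤1 (S e))

  uses-++ : ∀ A B e → uses (A ++ B) e ≡ uses A e ℕ.+ uses B e
  uses-++ []             B e = refl
  uses-++ ((e' , _) ∷ A) B e =
    trans (cong (𝟙 (does (e' ≟ e)) ℕ.+_) (uses-++ A B e)) (sym (ℕ.+-assoc _ (uses A e) (uses B e)))

  uses-↭ : ∀ {A B} → A ↭ B → ∀ e → uses A e ≡ uses B e
  uses-↭ ↭.refl                         e = refl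
  uses-↭ (↭.prep (e' , _) A↭B)          e = cong (𝟙 (does (e' ≟ e)) ℕ.+_) (uses-↭ A↭B e)
  uses-↭ (↭.swap (e₁ , _) (e₂ , _) A↭B) e =
    trans (cong (λ k → 𝟙 (does (e₁ ≟ e)) ℕ.+ (𝟙 (does (e₂ ≟ e)) ℕ.+ k)) (uses-↭ A↭B e))
          (x∙yz≈y∙xz (𝟙 (does (e₁ ≟ e))) (𝟙 (does (e₂ ≟ e))) _)
  uses-↭ (↭.trans A↭B B↭C)              e = trans (uses-↭ A↭B e) (uses-↭ B↭C e)

  trailIn-↭ : ∀ {S A B} → A ↭ B → TrailIn S A → TrailIn S B
  trailIn-↭ A↭B trail e = subst (ℕ._≤ _) (uses-↭ A↭B e) (trail e)

  trailIn-snoc : ∀ {S T e} b → TrailIn S T → Unused S T e → TrailIn S (T ∷ʳ (e , b))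
  trailIn-snoc {S} {T} {e} b trail (Se , unused) e' rewrite uses-++ T [ (e , b) ] e' with e ≟ e'
  ... | yes refl rewrite unused | Se = ℕ.≤-refl
  ... | no _ = subst (ℕ._≤ 𝟙 (S e')) (sym (ℕ.+-identityʳ _)) (trail e')

  sum-uses : ∀ T → ℕΣ.sum (uses T) ≡ length T
  sum-uses []            = ℕΣ.sum-replicate-zero m
  sum-uses ((e , b) ∷ T) = trans (ℕΣ.∑-distrib-+ (λ e' → 𝟙 (does (e ≟ e'))) (uses T))
    (cong₂ ℕ._+_ (trans (ℕΣ.sum-point (λ e' → 𝟙 (does (e ≟ e'))) e
                           (λ e' e'≢e → cong 𝟙 (dec-false (e ≟ e') (≢-sym e'≢e))))
                        (cong 𝟙 (dec-true (e ≟ e) refl)))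
                 (sum-uses T))

  edgeCount : EdgeSet m → ℕ
  edgeCount S = ℕΣ.sum (𝟙 ∘ S)

  length<edgeCount : ∀ {S T e} → TrailIn S T → Unused S T e → length T ℕ.< edgeCount S
  length<edgeCount {S} {T} {e} trail (Se , unused) =
    subst (ℕ._< edgeCount S) (sum-uses T) (sum-mono-< trail e gap)
    where
    gap : uses T e ℕ.< 𝟙 (S e)
    gap rewrite Se | unused = ℕ.≤-refl

  out-of-fuel : ∀ {S T e} → TrailIn S T → Unused S T e → ¬ (edgeCount S ℕ.≤ length T ℕ.+ 0)
  out-of-fuel {S} {T} {e} trail un fuel =
    ℕ.<⇒≱ (length<edgeCount {S} {T} {e} trail un) (subst (edgeCount S ℕ.≤_) (ℕ.+-identityʳ _) fuel)

  Through : Fin n → List (Step m) → Fin n → Fin n → Set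
  Through x C y z = ∃₂ λ A B → C ≡ A ++ B × Walk x A z × Walk z B y

  through-start : ∀ {x C y} → Walk x C y → Through x C y x
  through-start {C = C} w = [] , C , refl , [] , w

  through-step : ∀ {e b' C y} b → Walk (end G e (not b')) C y →
                 Through (end G e b') ((e , b') ∷ C) y (end G e b)
  through-step {e} {false} {C} false w = [] , _ , refl , [] , refl ∷ w
  through-step {e} {false} {C} true  w = [ (e , false) ] , C , refl , refl ∷ [] , w
  through-step {e} {true}  {C} false w = [ (e , true) ] , C , refl , refl ∷ [] , w
  through-step {e} {true}  {C} true  w = [] , _ , refl , [] , refl ∷ w

  through-used : ∀ {x C y e} → Walk x C y → 0 ℕ.< uses C e → ∀ b → Through x C y (end G e b)
  through-used {C = (e' , b') ∷ C} {e = e} (refl ∷ w) used b with e' ≟ e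
  ... | yes refl = through-step b w
  ... | no _ with through-used w used b
  ...   | A , B , refl , wA , wB = (e' , b') ∷ A , B , refl , refl ∷ wA , wB

  module _ (S : EdgeSet m) (even : ∀ u → 2 ℕ.∣ valency G S u) where

    -- if every edge of S at y were used, the walk's outflow at y would be ≡ valency ≡ 0 (mod 2),
    -- but it is ±1
    unused-at-end : ∀ {x T y} → Walk x T y → TrailIn S T → y ≢ x →
                    ∃₂ λ e b → Unused S T e × end G e b ≡ y
    unused-at-end {x} {T} {y} w trail y≢x
      with any? (λ e → unused? S T e ×-dec ((end G e false ≟ y) ⊎-dec (end G e true ≟ y)))
    ... | yes (e , un , inj₁ p) = e , false , un , p
    ... | yes (e , un , inj₂ p) = e , true  , un , p
    ... | no none = ⊥-elim (2∤-σ (exit true T) (subst (+ 2 ∣_) flow-at-y even-flow))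
      where
      ω = orient true T
      ξ : Fin m → ℤ
      ξ e = + uses T e
      no-ends : ∀ e → Unused S T e → ends e y ≡ 0
      no-ends e un = cong₂ ℕ._+_
        (cong 𝟙 (dec-false (end G e false ≟ y) (λ p → none (e , un , inj₁ p))))
        (cong 𝟙 (dec-false (end G e true ≟ y) (λ p → none (e , un , inj₂ p))))
      at-y : ∀ e → ξ e * + ends e y ≡ + (if S e then ends e y else 0)
      at-y e = trans (sym (ℤ.pos-* (uses T e) (ends e y)))
        (cong +_ (≤𝟙-* (S e) (uses T e) (ends e y) (trail e) (λ Se u≡0 → no-ends e (Se , u≡0))))
      sum-at-y : ℤΣ.sum (λ e → ξ e * + ends e y) ≡ + valency G S y
      sum-at-y = trans (ℤΣ.sum-cong-≗ at-y)
        (trans (sum-pos (λ e → if S e then ends e y else 0))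
               (cong +_ (sym (∑ℕ≡sum (λ e → if S e then ends e y else 0)))))
      even-flow : + 2 ∣ netFlow G ω ξ y
      even-flow = ∣-diff⇒∣ (subst (λ t → + 2 ∣ netFlow G ω ξ y - t) sum-at-y (netFlow-parity ω ξ y))
                           (∣ᵤ⇒∣ {+ 2} {+ valency G S y} (even y))
      flow-at-y : netFlow G ω ξ y ≡ 0ℤ - σ (exit true T)
      flow-at-y = trans (trail-netFlow w (trailIn⇒trail {S} {T} trail) true y)
        (cong₂ _-_ (point-≢ (σ true) (≢-sym y≢x)) (point-≡ y (σ (exit true T))))

    close : ∀ k {x y T} → Walk x T y → TrailIn S T → edgeCount S ℕ.≤ length T ℕ.+ k →
            ∃ λ Q → Walk y Q x × TrailIn S (T ++ Q)
    close k {x} {y} {T} w trail fuel with y ≟ x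
    ... | yes refl = [] , [] , subst (TrailIn S) (sym (List.++-identityʳ T)) trail
    ... | no y≢x with unused-at-end w trail y≢x
    ...   | e , b , un , refl with k
    ...     | ℕ.zero  = ⊥-elim (out-of-fuel {S} {T} {e} trail un fuel)
    ...     | ℕ.suc k with close k (w ++ʷ (refl ∷ [])) (trailIn-snoc {S} {T} {e} b trail un)
                                   (refuel fuel longer)
      where
      longer : length T ℕ.< length (T ∷ʳ (e , b))
      longer = subst (length T ℕ.<_) (sym (List.length-++ T)) (ℕ.m<m+n (length T) ℕ.≤-refl)
    ...       | Q , wQ , trailQ =
      (e , b) ∷ Q , refl ∷ wQ , subst (TrailIn S) (List.++-assoc T [ (e , b) ] Q) trailQ

    module _ (connected : ∀ u w → Incident G S u → Incident G S w → Reach G S u w)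
             (v : Fin n) (v∈S : Incident G S v) where

      first-unused : ∀ {C p w f} → Walk v C v → Reach G S p w → Through v C v p →
                     Unused S C f → end G f false ≡ w →
                     ∃₂ λ g b → Unused S C g × Through v C v (end G g b)
      first-unused {C} {f = f} wC here            th un f≡w =
        f , false , un , subst (Through v C v) (sym f≡w) th
      first-unused {C}         wC (step e b Se r) th un f≡w with uses C e in eq
      ... | ℕ.zero  = e , b , (Se , eq) , th
      ... | ℕ.suc _ =
        first-unused wC r (through-used wC (subst (0 ℕ.<_) (sym eq) (ℕ.s≤s ℕ.z≤n)) (not b)) un f≡w

      -- splice a closed trail through an unused edge g into C at a vertex where they meet
      enlarge : ∀ {C f} → Walk v C v → TrailIn S C → Unused S C f →
                ∃ λ C' → Walk v C' v × TrailIn S C' × length C ℕ.< length C'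
      enlarge {C} {f} wC trail un
        with first-unused wC (connected v (end G f false) v∈S (f , proj₁ un , inj₁ refl))
                          (through-start wC) un refl
      ... | g , b , (Sg , g-unused) , A , B , refl , wA , wB
        with close (edgeCount S) ((wB ++ʷ wA) ++ʷ (refl ∷ []))
                   (trailIn-snoc {S} {B ++ A} {g} b (trailIn-↭ rotate trail)
                                 (Sg , trans (sym (uses-↭ rotate g)) g-unused))
                   (ℕ.m≤n+m (edgeCount S) _)
        where rotate = ++-comm A B
      ... | Q , wQ , trailQ =
        A ++ (g , b) ∷ Q ++ B , wA ++ʷ (refl ∷ (wQ ++ʷ wB)) , trailIn-↭ reorder trailQ , longer
        where
        reorder : ((B ++ A) ∷ʳ (g , b)) ++ Q ↭ A ++ (g , b) ∷ Q ++ B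
        reorder = begin
          ((B ++ A) ++ [ (g , b) ]) ++ Q  ≡⟨ List.++-assoc (B ++ A) [ (g , b) ] Q ⟩
          (B ++ A) ++ (g , b) ∷ Q         ≡⟨ List.++-assoc B A ((g , b) ∷ Q) ⟩
          B ++ A ++ (g , b) ∷ Q           ↭⟨ ++-comm B (A ++ (g , b) ∷ Q) ⟩
          (A ++ (g , b) ∷ Q) ++ B         ≡⟨ List.++-assoc A ((g , b) ∷ Q) B ⟩
          A ++ (g , b) ∷ Q ++ B           ∎
          where open PermutationReasoning
        longer : length (A ++ B) ℕ.< length (A ++ (g , b) ∷ Q ++ B)
        longer = begin-strict
          length (A ++ B)                         ≡⟨ List.length-++ A ⟩
          length A ℕ.+ length B
            <⟨ ℕ.+-monoʳ-< (length A) (ℕ.s≤s (ℕ.m≤n+m (length B) (length Q))) ⟩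
          length A ℕ.+ ℕ.suc (length Q ℕ.+ length B)
            ≡⟨ cong (λ k → length A ℕ.+ ℕ.suc k) (List.length-++ Q) ⟨
          length A ℕ.+ length ((g , b) ∷ Q ++ B)  ≡⟨ List.length-++ A ⟨
          length (A ++ (g , b) ∷ Q ++ B)          ∎
          where open ℕ.≤-Reasoning

      cover : ∀ k {C} → Walk v C v → TrailIn S C → edgeCount S ℕ.≤ length C ℕ.+ k →
              ∃ λ C → Walk v C v × (∀ e → uses C e ≡ 𝟙 (S e))
      cover k {C} wC trail fuel with any? (unused? S C)
      ... | no none = C , wC , λ e → ≤𝟙-exact (trail e) (λ un → none (e , un))
      ... | yes (f , un) with k
      ...   | ℕ.zero  = ⊥-elim (out-of-fuel {S} {C} {f} trail un fuel)
      ...   | ℕ.suc k with enlarge wC trail un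
      ...     | C' , wC' , trail' , longer = cover k wC' trail' (refuel fuel longer)

      euler-circuit : ∃ λ C → Walk v C v × (∀ e → uses C e ≡ 𝟙 (S e))
      euler-circuit = cover (edgeCount S) [] (λ _ → ℕ.z≤n) ℕ.≤-refl

  -- The flow number

  TwoSource : EdgeSet m → Fin n → Orientation G → Set
  TwoSource S v ω = ∀ u → netFlow G ω (λ e → + 𝟙 (S e)) u ≡ point v (+ 2) u

  TwoSourceOrientation : EdgeSet m → Fin n → Set
  TwoSourceOrientation S v = Σ (Orientation G) λ ω → ValidOrientation G ω × TwoSource S v ω

  eulerian⇒twoSource : ∀ S v → EulerianSub G S → + 2 ∣ + negCount G S - 1ℤ → Incident G S v →
                       TwoSourceOrientation S v
  eulerian⇒twoSource S v (connected , even) odd v∈S with euler-circuit S even connected v v∈S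
  ... | C , wC , exact = ω , orient-valid true C , λ u →
    trans (flow u) (trans (cong (λ f → point v 1ℤ u - point v (σ f) u) exit-false)
                          (if-1-σfalse (does (v ≟ u))))
    where
    ω = orient true C
    ξ : Fin m → ℤ
    ξ e = + 𝟙 (S e)
    flow : ∀ u → netFlow G ω ξ u ≡ point v 1ℤ u - point v (σ (exit true C)) u
    flow u = trans (netFlow-congˡ ω (λ e → cong +_ (sym (exact e))) u)
      (trail-netFlow wC (λ e → subst (ℕ._≤ 1) (sym (exact e)) (𝟙≤1 (S e))) true u)
    total : ℤΣ.sum (netFlow G ω ξ) ≡ 1ℤ - σ (exit true C)
    total = begin
      ℤΣ.sum (netFlow G ω ξ)
        ≡⟨ ℤΣ.sum-cong-≗ (λ u →
             trans (flow u) (cong (λ t → point v 1ℤ u + t) (sym (if-neg (does (v ≟ u)) c)))) ⟩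
      ℤΣ.sum (λ u → point v 1ℤ u + point v (- c) u)
        ≡⟨ ℤΣ.∑-distrib-+ (point v 1ℤ) (point v (- c)) ⟩
      ℤΣ.sum (point v 1ℤ) + ℤΣ.sum (point v (- c))
        ≡⟨ cong₂ _+_ (sum-point-mass v 1ℤ) (sum-point-mass v (- c)) ⟩
      1ℤ - c                                                ∎
      where
      open ≡-Reasoning
      c = σ (exit true C)
    unit : UnitOn S ξ
    unit e with S e
    ... | true  = inj₁ refl
    ... | false = refl
    exit-false : exit true C ≡ false
    exit-false = 1-σ≢0 (exit true C) (λ total≡0 →
      sum-netFlow≢0 {ω} {ξ} S (orient-valid true C) unit odd (trans total total≡0))

  nowhere-zero-3-flow : ∀ {S₁ S₂ S₃} v → (∀ e → ExactlyOne (S₁ e) (S₂ e) (S₃ e)) →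
    TwoSourceOrientation S₁ v → TwoSourceOrientation S₂ v → TwoSourceOrientation S₃ v →
    HasNZFlow G 3
  nowhere-zero-3-flow {S₁} {S₂} {S₃} v partition (ω₁ , valid₁ , source₁) (ω₂ , valid₂ , source₂)
                                                  (ω₃ , valid₃ , source₃) =
    ω , patch-valid S₁ valid₁ (patch-valid S₂ valid₂ valid₃) , ξ , balanced ,
    λ e → exactlyOne-value (partition e)
    where
    ω = patch S₁ ω₁ (patch S₂ ω₂ ω₃)
    ξ₁ ξ₂ ξ₃ ξ : Fin m → ℤ
    ξ₁ e = + 𝟙 (S₁ e)
    ξ₂ e = + 𝟙 (S₂ e)
    ξ₃ e = + 𝟙 (S₃ e)
    ξ e = + 2 * ξ₁ e + (-1ℤ * ξ₂ e + -1ℤ * ξ₃ e)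
    agree : ∀ e → _
    agree e = exactlyOne-agree (ω₁ e) (ω₂ e) (ω₃ e) (partition e)
    vanish : ∀ p → + 2 * p + (-1ℤ * p + -1ℤ * p) ≡ 0ℤ
    vanish = solve-∀
    balanced : IsFlow G ω ξ
    balanced u = begin
      netFlow G ω ξ u
        ≡⟨ netFlow-+ ω (λ e → + 2 * ξ₁ e) (λ e → -1ℤ * ξ₂ e + -1ℤ * ξ₃ e) u ⟩
      netFlow G ω (λ e → + 2 * ξ₁ e) u + netFlow G ω (λ e → -1ℤ * ξ₂ e + -1ℤ * ξ₃ e) u
        ≡⟨ cong₂ _+_ (netFlow-* ω (+ 2) ξ₁ u)
                     (trans (netFlow-+ ω (λ e → -1ℤ * ξ₂ e) (λ e → -1ℤ * ξ₃ e) u)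
                            (cong₂ _+_ (netFlow-* ω -1ℤ ξ₂ u) (netFlow-* ω -1ℤ ξ₃ u))) ⟩
      + 2 * netFlow G ω ξ₁ u + (-1ℤ * netFlow G ω ξ₂ u + -1ℤ * netFlow G ω ξ₃ u)
        ≡⟨ cong₂ (λ a b → + 2 * a + b)
             (trans (netFlow-local ξ₁ (proj₁ ∘ agree) u) (source₁ u))
             (cong₂ (λ a b → -1ℤ * a + -1ℤ * b)
               (trans (netFlow-local ξ₂ (proj₁ ∘ proj₂ ∘ agree) u) (source₂ u))
               (trans (netFlow-local ξ₃ (proj₂ ∘ proj₂ ∘ agree) u) (source₃ u))) ⟩
      + 2 * point v (+ 2) u + (-1ℤ * point v (+ 2) u + -1ℤ * point v (+ 2) u)
        ≡⟨ vanish (point v (+ 2) u) ⟩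
      0ℤ ∎
      where open ≡-Reasoning

  odd-negatives : ∀ {S₁ S₂ S₃} → (∀ e → ExactlyOne (S₁ e) (S₂ e) (S₃ e)) →
    OddNegative G S₁ → OddNegative G S₂ → OddNegative G S₃ → + 2 ∣ + negCount G allEdges - 1ℤ
  odd-negatives {S₁} {S₂} {S₃} partition odd₁ odd₂ odd₃ =
    subst (λ t → + 2 ∣ t - 1ℤ) (sym (cong +_ split))
      (subst (λ t → + 2 ∣ t - 1ℤ) (sym (trans (ℤ.pos-+ a _) (cong (λ t → + a + t) (ℤ.pos-+ b c))))
        (∣-odd-sum₃ {+ a} {+ b} {+ c} (odd⇒∣pred odd₁) (odd⇒∣pred odd₂) (odd⇒∣pred odd₃)))
    where
    a = negCount G S₁
    b = negCount G S₂
    c = negCount G S₃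
    split : negCount G allEdges ≡ a ℕ.+ (b ℕ.+ c)
    split = begin
      negCount G allEdges
        ≡⟨ ∑ℕ≡sum (negative-in allEdges) ⟩
      ℕΣ.sum (negative-in allEdges)
        ≡⟨ ℕΣ.sum-cong-≗ (λ e → exactlyOne-split (if positive G e then 0 else 1) (partition e)) ⟩
      ℕΣ.sum (λ e → negative-in S₁ e ℕ.+ (negative-in S₂ e ℕ.+ negative-in S₃ e))
        ≡⟨ ℕΣ.∑-distrib-+ (negative-in S₁) (λ e → negative-in S₂ e ℕ.+ negative-in S₃ e) ⟩
      ℕΣ.sum (negative-in S₁) ℕ.+ ℕΣ.sum (λ e → negative-in S₂ e ℕ.+ negative-in S₃ e)
        ≡⟨ cong (ℕΣ.sum (negative-in S₁) ℕ.+_) (ℕΣ.∑-distrib-+ (negative-in S₂) (negative-in S₃)) ⟩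
      ℕΣ.sum (negative-in S₁) ℕ.+ (ℕΣ.sum (negative-in S₂) ℕ.+ ℕΣ.sum (negative-in S₃))
        ≡⟨ cong₂ ℕ._+_ (∑ℕ≡sum (negative-in S₁))
                       (cong₂ ℕ._+_ (∑ℕ≡sum (negative-in S₂)) (∑ℕ≡sum (negative-in S₃))) ⟨
      a ℕ.+ (b ℕ.+ c) ∎
      where open ≡-Reasoning

  nowhere-zero-flow-≥3 : ∀ {k} → Fin m → + 2 ∣ + negCount G allEdges - 1ℤ → HasNZFlow G k → 3 ℕ.≤ k
  nowhere-zero-flow-≥3 {0} e _ (_ , _ , _ , _ , nz) = ⊥-elim (ℕ.n≮0 (proj₂ (nz e)))
  nowhere-zero-flow-≥3 {1} e _ (_ , _ , _ , _ , nz) =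
    ⊥-elim (proj₁ (nz e) (ℤ.∣i∣≡0⇒i≡0 (ℕ.n<1⇒n≡0 (proj₂ (nz e)))))
  nowhere-zero-flow-≥3 {2} _ odd (ω , valid , ξ , flow , nz) =
    ⊥-elim (sum-netFlow≢0 {ω} {ξ} allEdges valid
                          (λ e → unit-if-small (ξ e) (proj₁ (nz e)) (proj₂ (nz e))) odd
                          (trans (ℤΣ.sum-cong-≗ flow) (ℤΣ.sum-replicate-zero n)))
  nowhere-zero-flow-≥3 {ℕ.suc (ℕ.suc (ℕ.suc _))} _ _ _ = ℕ.s≤s (ℕ.s≤s (ℕ.s≤s ℕ.z≤n))

proposition11 : ∀ {n m} (G : SignedGraph n m) → Eulerian G →
    (S₁ S₂ S₃ : EdgeSet m) →
    (∀ e → (S₁ e ≡ true × S₂ e ≡ false × S₃ e ≡ false)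
         Data.Sum.⊎ ((S₁ e ≡ false × S₂ e ≡ true × S₃ e ≡ false)
         Data.Sum.⊎ (S₁ e ≡ false × S₂ e ≡ false × S₃ e ≡ true))) →
    EulerianSub G S₁ → EulerianSub G S₂ → EulerianSub G S₃ →
    OddNegative G S₁ → OddNegative G S₂ → OddNegative G S₃ →
    (v : Fin n) → Incident G S₁ v → Incident G S₂ v → Incident G S₃ v →
    FlowNumberIs G 3
proposition11 G _ S₁ S₂ S₃ partition E₁ E₂ E₃ O₁ O₂ O₃ v I₁ I₂ I₃ =
  nowhere-zero-3-flow G v partition (source S₁ E₁ O₁ I₁) (source S₂ E₂ O₂ I₂) (source S₃ E₃ O₃ I₃) ,
  λ j j<3 flow →
    ℕ.<⇒≱ j<3 (nowhere-zero-flow-≥3 G (proj₁ I₁) (odd-negatives G partition O₁ O₂ O₃) flow)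
  where
  source : ∀ S → EulerianSub G S → OddNegative G S → Incident G S v → TwoSourceOrientation G S v
  source S eulerian odd v∈S = eulerian⇒twoSource G S v eulerian (odd⇒∣pred odd) v∈S
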